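{- For a threshold graph $G$ with $n$ vertices, the matching number satisfies $$\nu(G)=\left\lfloor\frac{n-h(\mathrm{seq}(G))}{2}\right\rfloor.$$
   Context: $\nu(G)$ is the number of edges in a maximum matching of $G$. A threshold graph on $n$ vertices is built from a single base vertex by adding $n-1$ vertices one at a time, each either isolated or dominating (adjacent to all existing vertices); its creation sequence $\mathrm{seq}(G)=s_1\dots s_{n-1}$ has $s_i=1$ if the $i$-th added vertex was dominating and $s_i=0$ if isolated. For a binary sequence $s$ of length $m$ and $0\le k\le m$, let $z_k(s)$ and $u_k(s)$ be the numbers of zeros and ones among the last $k$ digits of $s$, and $h(s)=\max_{0\le k\le m}\{z_k(s)-u_k(s)\}$. -}

module Defs where

open import Data.Nat using (ℕ; zero; suc; _<_)
open import Data.Bool using (Bool; true; false; T)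
open import Data.Fin using (Fin; toℕ) renaming (zero to fzero; suc to fsuc)
open import Data.Vec using (Vec; lookup; toList)
open import Data.List using (List; []; _∷_; length; map; drop; upTo; foldr; concatMap)
open import Data.List.Relation.Unary.All using (All)
open import Data.List.Relation.Unary.Unique.Propositional using (Unique)
open import Data.Product using (_×_; _,_; Σ)
open import Data.Sum using (_⊎_)
open import Data.Integer as ℤ using (ℤ; +_; _-_; _⊔_)

-- Threshold graph from a creation sequence s = s₁ … s_m (n = m+1 vertices).
-- Vertex 0 is the base vertex; vertex k (1 ≤ k ≤ m) is the k-th added vertex,
-- whose digit is s_k = lookup s (k-1).

-- digit of a non-base vertex; the base vertex has no digit
digit : ∀ {m} → Vec Bool m → Fin (suc m) → Bool
digit s fzero    = false
digit s (fsuc k) = lookup s k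

-- i and j adjacent iff the later of the two was added as a dominating vertex
Adj : ∀ {m} → Vec Bool m → Fin (suc m) → Fin (suc m) → Set
Adj s i j = (toℕ i < toℕ j × T (digit s j)) ⊎ (toℕ j < toℕ i × T (digit s i))

endpoints : ∀ {n} → List (Fin n × Fin n) → List (Fin n)
endpoints = concatMap (λ { (a , b) → a ∷ b ∷ [] })

IsMatching : ∀ {n} → (Fin n → Fin n → Set) → List (Fin n × Fin n) → Set
IsMatching adj M = All (λ { (a , b) → adj a b }) M × Unique (endpoints M)

IsMatchingNumber : ∀ {n} → (Fin n → Fin n → Set) → ℕ → Set
IsMatchingNumber {n} adj k =
  Σ (List (Fin n × Fin n)) (λ M → IsMatching adj M × length M ≡ k)
  × (∀ (M : List (Fin n × Fin n)) → IsMatching adj M → length M Data.Nat.≤ k)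
  where open import Relation.Binary.PropositionalEquality using (_≡_)

zeros ones : List Bool → ℕ
zeros []           = 0
zeros (false ∷ xs) = suc (zeros xs)
zeros (true ∷ xs)  = zeros xs
ones []           = 0
ones (true ∷ xs)  = suc (ones xs)
ones (false ∷ xs) = ones xs

lastDigits : ∀ {m} → Vec Bool m → ℕ → List Bool
lastDigits {m} s k = drop (m Data.Nat.∸ k) (toList s)

z u : ∀ {m} → Vec Bool m → ℕ → ℕ
z s k = zeros (lastDigits s k)
u s k = ones (lastDigits s k)

h : ∀ {m} → Vec Bool m → ℤ
h {m} s = foldr _⊔_ (+ 0) (map (λ k → + z s k - + u s k) (upTo (suc m)))

-- A vertex added as isolated is adjacent only to dominating vertices added after it. So among
-- the last k vertices every matched zero is matched to its own one, at least z_k − u_k of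
-- them stay unmatched, and a matching has at most (n − h) / 2 edges.
-- Conversely h(s0) = h(s) + 1 and h(s1) = max(0, h(s) − 1); the greedy matching, which pairs
-- every new dominating vertex with a free vertex whenever there is one, has at least
-- ⌊(n − h) / 2⌋ edges by induction along the creation sequence.
module Submission where

open import Defs
open import Data.Bool using (Bool; true; false; not; _∧_; T; if_then_else_)
open import Data.Empty using (⊥-elim)
open import Data.Unit using (tt)
open import Data.Fin as Fin using (Fin; toℕ; inject₁; fromℕ) renaming (zero to fzero; suc to fsuc)
open import Data.Fin.Properties
  using (toℕ-inject₁; toℕ-fromℕ; toℕ<n; inject₁-injective; fromℕ≢inject₁)
open import Data.Integer as ℤ using (ℤ; +_; _-_; _⊔_; ∣_∣)
import Data.Integer.Properties as ℤₚ
import Data.Integer.Tactic.RingSolver as ℤ-Solver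
open import Data.List
  using (List; []; _∷_; [_]; _++_; length; map; filterᵇ; drop; take; foldr; allFin; upTo; tabulate)
open import Data.List.Properties
  using (length-map; length-take; length-tabulate; map-tabulate; drop-all; foldr-preservesᵇ)
open import Data.List.Membership.Propositional using (_∈_; _∉_; lose)
open import Data.List.Membership.Propositional.Properties
  using (∈-∃++; ∈-++⁻; ∈-++⁺ˡ; ∈-++⁺ʳ; ∈-filter⁺; ∈-filter⁻; ∈-allFin; ∈-map⁺; ∈-map⁻; ∈-upTo⁺; ∈-upTo⁻;
         foldr-selective)
open import Data.List.Relation.Binary.Permutation.Propositional.Properties using (↭-length; shift)
open import Data.List.Relation.Binary.Subset.Propositional using (_⊆_)
open import Data.List.Relation.Unary.All as All using (All; []; _∷_)
import Data.List.Relation.Unary.All.Properties as Allₚ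
open import Data.List.Relation.Unary.Any using (here; there; any?; satisfied)
open import Data.List.Relation.Unary.Unique.Propositional using (Unique; []; _∷_)
import Data.List.Relation.Unary.Unique.Propositional.Properties as Uniqueₚ
open import Data.Nat using (ℕ; zero; suc; _+_; _∸_; _≤_; _<_; _<ᵇ_; _/_; ⌊_/2⌋; ⌈_/2⌉; z≤n; s≤s)
open import Data.Nat.Properties
  using (≤-refl; ≤-trans; ≤-reflexive; ≤-pred; <-trans; <ᵇ⇒<; <⇒<ᵇ; +-suc; +-comm; +-mono-≤; +-monoʳ-≤;
         +-cancelʳ-≤; m∸n≤m; n≤1+n; m+n≤o⇒m≤o∸n; m≤n⇒m⊓n≡m; ⌊n/2⌋-mono; n≡⌊n+n/2⌋;
         +-commutativeSemigroup; module ≤-Reasoning)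
open import Data.Nat.DivMod using (m/n≡1+[m∸n]/n)
import Data.Nat.Tactic.RingSolver as ℕ-Solver
open import Algebra.Properties.CommutativeSemigroup +-commutativeSemigroup using (x∙yz≈y∙xz)
open import Data.Product as Product using (_×_; _,_; ∃-syntax; Σ-syntax)
open import Data.Sum as Sum using (_⊎_; inj₁; inj₂)
open import Data.Vec using (Vec; _∷ʳ_; toList; lookup; initLast) renaming ([] to []ᵛ; _∷_ to _∷ᵛ_)
open import Data.Vec.Properties using (toList-∷ʳ; length-toList)
open import Function using (_∘_; id)
open import Relation.Nullary using (yes; no; ¬?)
open import Relation.Nullary.Decidable using (T?; decidable-stable)
open import Relation.Binary.PropositionalEquality
  using (_≡_; refl; sym; trans; cong; cong₂; subst; subst₂; module ≡-Reasoning)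

private variable A B : Set

-- Counting

count : (A → Bool) → List A → ℕ
count p []       = 0
count p (x ∷ xs) = if p x then suc (count p xs) else count p xs

count≡length∘filterᵇ : ∀ (p : A → Bool) xs → count p xs ≡ length (filterᵇ p xs)
count≡length∘filterᵇ p []       = refl
count≡length∘filterᵇ p (x ∷ xs) with p x
... | true  = cong suc (count≡length∘filterᵇ p xs)
... | false = count≡length∘filterᵇ p xs

count-++ : ∀ (p : A → Bool) xs ys → count p (xs ++ ys) ≡ count p xs + count p ys
count-++ p []       ys = refl
count-++ p (x ∷ xs) ys with p x
... | true  = cong suc (count-++ p xs ys)
... | false = count-++ p xs ys

count-swap : ∀ (p : A → Bool) x y xs → count p (x ∷ y ∷ xs) ≡ count p (y ∷ x ∷ xs)
count-swap p x y xs with p x | p y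
... | true  | true  = refl
... | true  | false = refl
... | false | true  = refl
... | false | false = refl

count-map : ∀ (p : B → Bool) (f : A → B) xs → count p (map f xs) ≡ count (p ∘ f) xs
count-map p f []       = refl
count-map p f (x ∷ xs) with p (f x)
... | true  = cong suc (count-map p f xs)
... | false = count-map p f xs

count-tabulate : ∀ {n} (p : A → Bool) (f : Fin n → A) → count p (tabulate f) ≡ count (p ∘ f) (allFin n)
count-tabulate {n = n} p f = trans (cong (count p) (sym (map-tabulate id f))) (count-map p f (allFin n))

length≡count+count-not : ∀ (p : A → Bool) xs → length xs ≡ count p xs + count (not ∘ p) xs
length≡count+count-not p []       = refl
length≡count+count-not p (x ∷ xs) with p x
... | true  = cong suc (length≡count+count-not p xs)
... | false = trans (cong suc (length≡count+count-not p xs)) (sym (+-suc _ _))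

Unique⇒length≤ : ∀ {xs ys : List A} → Unique xs → xs ⊆ ys → length xs ≤ length ys
Unique⇒length≤ {xs = []}     _            _     = z≤n
Unique⇒length≤ {xs = x ∷ xs} (x∉xs ∷ uxs) xs⊆ys with as , bs , refl ← ∈-∃++ (xs⊆ys (here refl)) =
  ≤-trans (s≤s (Unique⇒length≤ uxs xs⊆as++bs)) (≤-reflexive (sym (↭-length (shift x as bs))))
  where
  xs⊆as++bs : xs ⊆ as ++ bs
  xs⊆as++bs {y} y∈xs with ∈-++⁻ as (xs⊆ys (there y∈xs))
  ... | inj₁ y∈as         = ∈-++⁺ˡ y∈as
  ... | inj₂ (here refl)  = ⊥-elim (All.lookup x∉xs y∈xs refl)
  ... | inj₂ (there y∈bs) = ∈-++⁺ʳ as y∈bs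

count-mono : ∀ (p : A → Bool) {xs ys} → Unique xs → xs ⊆ ys → count p xs ≤ count p ys
count-mono p {xs} {ys} uxs xs⊆ys =
  subst₂ _≤_ (sym (count≡length∘filterᵇ p xs)) (sym (count≡length∘filterᵇ p ys))
  (Unique⇒length≤ (Uniqueₚ.filter⁺ (T? ∘ p) uxs) λ v∈ →
    let v∈xs , pv = ∈-filter⁻ (T? ∘ p) v∈ in ∈-filter⁺ (T? ∘ p) (xs⊆ys v∈xs) pv)

free-or-covered : ∀ {n} (xs : List (Fin n)) → (∃[ v ] v ∉ xs) ⊎ n ≤ length xs
free-or-covered {n} xs with any? (λ v → ¬? (any? (v Fin.≟_) xs)) (allFin n)
... | yes free  = inj₁ (satisfied free)
... | no ¬free =
  inj₂ (subst (_≤ length xs) (length-tabulate id) (Unique⇒length≤ (Uniqueₚ.allFin⁺ n) covered))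
  where
  covered : allFin n ⊆ xs
  covered {v} _ = decidable-stable (any? (v Fin.≟_) xs) λ v∉xs → ¬free (lose (∈-allFin v) v∉xs)

-- Digits and the statistic h

zeros-++ : ∀ xs ys → zeros (xs ++ ys) ≡ zeros xs + zeros ys
zeros-++ []           ys = refl
zeros-++ (false ∷ xs) ys = cong suc (zeros-++ xs ys)
zeros-++ (true ∷ xs)  ys = zeros-++ xs ys

ones-++ : ∀ xs ys → ones (xs ++ ys) ≡ ones xs + ones ys
ones-++ []           ys = refl
ones-++ (false ∷ xs) ys = ones-++ xs ys
ones-++ (true ∷ xs)  ys = cong suc (ones-++ xs ys)

zeros≡count-not : ∀ xs → zeros xs ≡ count not xs
zeros≡count-not []           = refl
zeros≡count-not (false ∷ xs) = cong suc (zeros≡count-not xs)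
zeros≡count-not (true ∷ xs)  = zeros≡count-not xs

ones≡count-id : ∀ xs → ones xs ≡ count id xs
ones≡count-id []           = refl
ones≡count-id (false ∷ xs) = ones≡count-id xs
ones≡count-id (true ∷ xs)  = cong suc (ones≡count-id xs)

balance : List Bool → ℤ
balance xs = + zeros xs - + ones xs

balance-++ : ∀ xs ys → balance (xs ++ ys) ≡ balance xs ℤ.+ balance ys
balance-++ xs ys
  rewrite zeros-++ xs ys | ones-++ xs ys
        | ℤₚ.pos-+ (zeros xs) (zeros ys) | ℤₚ.pos-+ (ones xs) (ones ys)
        = rearrange (+ zeros xs) (+ ones xs) (+ zeros ys) (+ ones ys)
  where
  rearrange : ∀ a b c d → (a ℤ.+ c) - (b ℤ.+ d) ≡ (a - b) ℤ.+ (c - d)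
  rearrange = ℤ-Solver.solve-∀

drop-++ : ∀ n (xs ys : List A) → n ≤ length xs → drop n (xs ++ ys) ≡ drop n xs ++ ys
drop-++ zero    xs       ys _         = refl
drop-++ (suc n) (x ∷ xs) ys (s≤s n≤l) = drop-++ n xs ys n≤l

lastDigits-zero : ∀ {m} (s : Vec Bool m) → lastDigits s 0 ≡ []
lastDigits-zero {m} s = drop-all m (toList s) (≤-reflexive (length-toList s))

lastDigits-∷ʳ : ∀ {m} (s : Vec Bool m) b k → lastDigits (s ∷ʳ b) (suc k) ≡ lastDigits s k ++ [ b ]
lastDigits-∷ʳ {m} s b k = trans (cong (drop (m ∸ k)) (toList-∷ʳ b s))
  (drop-++ (m ∸ k) (toList s) [ b ] (≤-trans (m∸n≤m m k) (≤-reflexive (sym (length-toList s)))))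

excess : ∀ {m} → Vec Bool m → ℕ → ℤ
excess s k = balance (lastDigits s k)

excess-zero : ∀ {m} (s : Vec Bool m) → excess s 0 ≡ + 0
excess-zero s = cong balance (lastDigits-zero s)

excess-∷ʳ : ∀ {m} (s : Vec Bool m) b k → excess (s ∷ʳ b) (suc k) ≡ balance [ b ] ℤ.+ excess s k
excess-∷ʳ s b k = trans (cong balance (lastDigits-∷ʳ s b k))
  (trans (balance-++ (lastDigits s k) [ b ]) (ℤₚ.+-comm (excess s k) (balance [ b ])))

≤-foldr-⊔ : ∀ {x e} xs → x ∈ xs → x ℤ.≤ foldr _⊔_ e xs
≤-foldr-⊔ (y ∷ xs) (here refl)  = ℤₚ.i≤i⊔j y _
≤-foldr-⊔ (y ∷ xs) (there x∈xs) = ℤₚ.≤-trans (≤-foldr-⊔ xs x∈xs) (ℤₚ.i≤j⊔i y _)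

excess≤h : ∀ {m} (s : Vec Bool m) {k} → k ≤ m → excess s k ℤ.≤ h s
excess≤h s k≤m = ≤-foldr-⊔ _ (∈-map⁺ (excess s) (∈-upTo⁺ (s≤s k≤m)))

h-least : ∀ {m} (s : Vec Bool m) {y} → (∀ k → k ≤ m → excess s k ℤ.≤ y) → h s ℤ.≤ y
h-least s bound = foldr-preservesᵇ ℤₚ.⊔-lub
  (subst (ℤ._≤ _) (excess-zero s) (bound 0 z≤n))
  (All.tabulate λ x∈ → let k , k∈ , x≡ = ∈-map⁻ (excess s) x∈ in
    subst (ℤ._≤ _) (sym x≡) (bound k (≤-pred (∈-upTo⁻ k∈))))

h-attained : ∀ {m} (s : Vec Bool m) → ∃[ k ] k ≤ m × excess s k ≡ h s
h-attained {m} s with foldr-selective ℤₚ.⊔-sel (+ 0) (map (excess s) (upTo (suc m)))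
... | inj₁ h≡0 = 0 , z≤n , trans (excess-zero s) (sym h≡0)
... | inj₂ h∈  = let k , k∈ , h≡ = ∈-map⁻ (excess s) h∈ in k , ≤-pred (∈-upTo⁻ k∈) , sym h≡

0≤h : ∀ {m} (s : Vec Bool m) → + 0 ℤ.≤ h s
0≤h s = subst (ℤ._≤ h s) (excess-zero s) (excess≤h s z≤n)

h-∷ʳ : ∀ {m} (s : Vec Bool m) b → h (s ∷ʳ b) ≡ + 0 ⊔ (balance [ b ] ℤ.+ h s)
h-∷ʳ {m} s b = ℤₚ.≤-antisym (h-least (s ∷ʳ b) bound) (ℤₚ.⊔-lub (0≤h (s ∷ʳ b)) reached)
  where
  open ℤₚ.≤-Reasoning
  bound : ∀ k → k ≤ suc m → excess (s ∷ʳ b) k ℤ.≤ + 0 ⊔ (balance [ b ] ℤ.+ h s)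
  bound zero    _         = begin
    excess (s ∷ʳ b) 0             ≡⟨ excess-zero (s ∷ʳ b) ⟩
    + 0                           ≤⟨ ℤₚ.i≤i⊔j (+ 0) _ ⟩
    + 0 ⊔ (balance [ b ] ℤ.+ h s) ∎
  bound (suc k) (s≤s k≤m) = begin
    excess (s ∷ʳ b) (suc k)       ≡⟨ excess-∷ʳ s b k ⟩
    balance [ b ] ℤ.+ excess s k  ≤⟨ ℤₚ.+-monoʳ-≤ (balance [ b ]) (excess≤h s k≤m) ⟩
    balance [ b ] ℤ.+ h s         ≤⟨ ℤₚ.i≤j⊔i (+ 0) _ ⟩
    + 0 ⊔ (balance [ b ] ℤ.+ h s) ∎
  reached : balance [ b ] ℤ.+ h s ℤ.≤ h (s ∷ʳ b)
  reached with k , k≤m , excess≡h ← h-attained s = begin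
    balance [ b ] ℤ.+ h s         ≡⟨ cong (λ x → balance [ b ] ℤ.+ x) excess≡h ⟨
    balance [ b ] ℤ.+ excess s k  ≡⟨ excess-∷ʳ s b k ⟨
    excess (s ∷ʳ b) (suc k)       ≤⟨ excess≤h (s ∷ʳ b) (s≤s k≤m) ⟩
    h (s ∷ʳ b)                    ∎

∣h∣-∷ʳ-false : ∀ {m} (s : Vec Bool m) → ∣ h (s ∷ʳ false) ∣ ≡ suc ∣ h s ∣
∣h∣-∷ʳ-false s rewrite h-∷ʳ s false | sym (ℤₚ.0≤i⇒+∣i∣≡i (0≤h s)) = refl

∣h∣-∷ʳ-true : ∀ {m} (s : Vec Bool m) → ∣ h (s ∷ʳ true) ∣ ≡ ∣ h s ∣ ∸ 1
∣h∣-∷ʳ-true s rewrite h-∷ʳ s true | sym (ℤₚ.0≤i⇒+∣i∣≡i (0≤h s)) with ∣ h s ∣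
... | zero  = refl
... | suc _ = refl

+a-+b≡+c⇒a≡b+c : ∀ {a b c} → + a - + b ≡ + c → a ≡ b + c
+a-+b≡+c⇒a≡b+c {a} {b} {c} eq = ℤₚ.+-injective (begin
  + a                  ≡⟨ split (+ a) (+ b) ⟩
  + b ℤ.+ (+ a - + b)  ≡⟨ cong (λ x → + b ℤ.+ x) eq ⟩
  + b ℤ.+ + c          ≡⟨ ℤₚ.pos-+ b c ⟨
  + (b + c)            ∎)
  where
  open ≡-Reasoning
  split : ∀ x y → x ≡ y ℤ.+ (x - y)
  split = ℤ-Solver.solve-∀

-- Matchings in threshold graphs

length-endpoints : ∀ {n} (M : List (Fin n × Fin n)) → length (endpoints M) ≡ length M + length M
length-endpoints []            = refl
length-endpoints ((a , b) ∷ M) =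
  cong suc (trans (cong suc (length-endpoints M)) (sym (+-suc (length M) (length M))))

count-digitsAfter : ∀ {m} (s : Vec Bool m) t (g : Bool → Bool) →
  count (λ v → (t <ᵇ toℕ v) ∧ g (digit s v)) (allFin (suc m)) ≡ count g (drop t (toList s))
count-digitsAfter {m} s t g = trans (count-tabulate {n = m} _ fsuc) (go s t)
  where
  go : ∀ {m} (s : Vec Bool m) t →
    count (λ i → (t <ᵇ suc (toℕ i)) ∧ g (lookup s i)) (allFin m) ≡ count g (drop t (toList s))
  go []ᵛ       zero    = refl
  go []ᵛ       (suc t) = refl
  go {suc m} (x ∷ᵛ s) zero with g x
  ... | true  = cong suc (trans (count-tabulate {n = m} _ fsuc) (go s zero))
  ... | false = trans (count-tabulate {n = m} _ fsuc) (go s zero)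
  go {suc m} (x ∷ᵛ s) (suc t) = trans (count-tabulate {n = m} _ fsuc) (go s t)

module _ {m} (s : Vec Bool m) (k : ℕ) where

  -- The vertices carrying the last k digits of s (all non-base vertices when k > m).
  isLate : Fin (suc m) → Bool
  isLate v = m ∸ k <ᵇ toℕ v

  isLateZero isLateOne : Fin (suc m) → Bool
  isLateZero v = isLate v ∧ not (digit s v)
  isLateOne  v = isLate v ∧ digit s v

  count-isLateZero : count isLateZero (allFin (suc m)) ≡ z s k
  count-isLateZero = trans (count-digitsAfter s (m ∸ k) not) (sym (zeros≡count-not (lastDigits s k)))

  count-isLateOne : count isLateOne (allFin (suc m)) ≡ u s k
  count-isLateOne = trans (count-digitsAfter s (m ∸ k) id) (sym (ones≡count-id (lastDigits s k)))

  -- Only a late zero a needs an argument: its neighbour b comes after it, so b is late as well.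
  isLateZero-edge : ∀ {a b} → toℕ a < toℕ b → T (digit s b) →
    count isLateZero (a ∷ b ∷ []) ≤ count isLateOne (a ∷ b ∷ [])
  isLateZero-edge {a} {b} a<b b-dominating
    with digit s b | isLate a in a-late | digit s a | isLate b in b-late
  ... | true | false | _     | false = z≤n
  ... | true | false | _     | true  = z≤n
  ... | true | true  | true  | false = z≤n
  ... | true | true  | true  | true  = z≤n
  ... | true | true  | false | true  = s≤s z≤n
  ... | true | true  | false | false =
    ⊥-elim (subst T b-late (<⇒<ᵇ (<-trans (<ᵇ⇒< _ _ (subst T (sym a-late) tt)) a<b)))

  count-isLateZero≤count-isLateOne : ∀ {M} → All (λ { (a , b) → Adj s a b }) M →
    count isLateZero (endpoints M) ≤ count isLateOne (endpoints M)
  count-isLateZero≤count-isLateOne [] = z≤n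
  count-isLateZero≤count-isLateOne {(a , b) ∷ M} (a~b ∷ adjacent) = begin
    count isLateZero (a ∷ b ∷ endpoints M)
      ≡⟨ count-++ isLateZero (a ∷ b ∷ []) (endpoints M) ⟩
    count isLateZero (a ∷ b ∷ []) + count isLateZero (endpoints M)
      ≤⟨ +-mono-≤ (edge a~b) (count-isLateZero≤count-isLateOne adjacent) ⟩
    count isLateOne (a ∷ b ∷ []) + count isLateOne (endpoints M)
      ≡⟨ count-++ isLateOne (a ∷ b ∷ []) (endpoints M) ⟨
    count isLateOne (a ∷ b ∷ endpoints M) ∎
    where
    open ≤-Reasoning
    edge : Adj s a b → count isLateZero (a ∷ b ∷ []) ≤ count isLateOne (a ∷ b ∷ [])
    edge (inj₁ (a<b , b-dominating)) = isLateZero-edge a<b b-dominating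
    edge (inj₂ (b<a , a-dominating)) =
      subst₂ _≤_ (count-swap isLateZero b a []) (count-swap isLateOne b a [])
        (isLateZero-edge b<a a-dominating)

  matching-bound : ∀ {M} → IsMatching (Adj s) M → z s k + (length M + length M) ≤ u s k + suc m
  matching-bound {M} (adjacent , distinct) = begin
    z s k + (length M + length M)     ≡⟨ cong₂ _+_ (sym count-isLateZero) (sym (length-endpoints M)) ⟩
    Z + length E                      ≡⟨ cong (λ x → Z + x) (length≡count+count-not isLateZero E) ⟩
    Z + (count isLateZero E + count (not ∘ isLateZero) E)
      ≤⟨ +-monoʳ-≤ Z (+-mono-≤
           (≤-trans (count-isLateZero≤count-isLateOne adjacent) (count-mono isLateOne distinct all))
           (count-mono (not ∘ isLateZero) distinct all)) ⟩
    Z + (U + count (not ∘ isLateZero) V) ≡⟨ x∙yz≈y∙xz Z U _ ⟩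
    U + (Z + count (not ∘ isLateZero) V) ≡⟨ cong (λ x → U + x) (length≡count+count-not isLateZero V) ⟨
    U + length V                         ≡⟨ cong₂ _+_ count-isLateOne (length-tabulate id) ⟩
    u s k + suc m                        ∎
    where
    open ≤-Reasoning
    E = endpoints M
    V = allFin (suc m)
    Z = count isLateZero V
    U = count isLateOne V
    all : E ⊆ V
    all {v} _ = ∈-allFin v

νFormula : ∀ {m} → Vec Bool m → ℕ
νFormula {m} s = ⌊ (suc m ∸ ∣ h s ∣) /2⌋

matching-size≤νFormula : ∀ {m} (s : Vec Bool m) {M} → IsMatching (Adj s) M → length M ≤ νFormula s
matching-size≤νFormula {m} s {M} matching with k , _ , excess≡h ← h-attained s =
  subst (_≤ νFormula s) (sym (n≡⌊n+n/2⌋ (length M)))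
    (⌊n/2⌋-mono (m+n≤o⇒m≤o∸n (length M + length M) 2∣M∣+H≤n))
  where
  open ≤-Reasoning
  H = ∣ h s ∣
  z≡u+H : z s k ≡ u s k + H
  z≡u+H = +a-+b≡+c⇒a≡b+c (trans excess≡h (sym (ℤₚ.0≤i⇒+∣i∣≡i (0≤h s))))
  2∣M∣+H≤n : length M + length M + H ≤ suc m
  2∣M∣+H≤n = +-cancelʳ-≤ (u s k) _ _ (begin
    length M + length M + H + u s k   ≡⟨ rearrange (length M + length M) H (u s k) ⟩
    (u s k + H) + (length M + length M) ≡⟨ cong (_+ (length M + length M)) z≡u+H ⟨
    z s k + (length M + length M)     ≤⟨ matching-bound s k matching ⟩
    u s k + suc m                     ≡⟨ +-comm (u s k) (suc m) ⟩
    suc m + u s k                     ∎)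
    where
    rearrange : ∀ x y w → x + y + w ≡ (w + y) + x
    rearrange = ℕ-Solver.solve-∀

lookup-inject₁-∷ʳ : ∀ {m} (s : Vec A m) b i → lookup (s ∷ʳ b) (inject₁ i) ≡ lookup s i
lookup-inject₁-∷ʳ (x ∷ᵛ s) b fzero    = refl
lookup-inject₁-∷ʳ (x ∷ᵛ s) b (fsuc i) = lookup-inject₁-∷ʳ s b i

lookup-fromℕ-∷ʳ : ∀ {m} (s : Vec A m) b → lookup (s ∷ʳ b) (fromℕ m) ≡ b
lookup-fromℕ-∷ʳ []ᵛ       b = refl
lookup-fromℕ-∷ʳ (x ∷ᵛ s) b = lookup-fromℕ-∷ʳ s b

digit-inject₁-∷ʳ : ∀ {m} (s : Vec Bool m) b v → digit (s ∷ʳ b) (inject₁ v) ≡ digit s v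
digit-inject₁-∷ʳ s b fzero    = refl
digit-inject₁-∷ʳ s b (fsuc i) = lookup-inject₁-∷ʳ s b i

Adj-inject₁ : ∀ {m} (s : Vec Bool m) b {v w} → Adj s v w → Adj (s ∷ʳ b) (inject₁ v) (inject₁ w)
Adj-inject₁ s b = Sum.map later later
  where
  later : ∀ {v w} → toℕ v < toℕ w × T (digit s w) →
    toℕ (inject₁ v) < toℕ (inject₁ w) × T (digit (s ∷ʳ b) (inject₁ w))
  later {v} {w} (v<w , w-dominating) =
    subst₂ _<_ (sym (toℕ-inject₁ v)) (sym (toℕ-inject₁ w)) v<w ,
    subst T (sym (digit-inject₁-∷ʳ s b w)) w-dominating

Adj-new : ∀ {m} (s : Vec Bool m) v → Adj (s ∷ʳ true) (fromℕ (suc m)) (inject₁ v)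
Adj-new {m} s v = inj₂ (subst₂ _<_ (sym (toℕ-inject₁ v)) (sym (toℕ-fromℕ (suc m))) (toℕ<n v) ,
                        subst T (sym (lookup-fromℕ-∷ʳ s true)) tt)

injectEdge : ∀ {n} → Fin n × Fin n → Fin (suc n) × Fin (suc n)
injectEdge = Product.map inject₁ inject₁

endpoints-map : ∀ {n n′} (f : Fin n → Fin n′) (M : List (Fin n × Fin n)) →
  endpoints (map (Product.map f f) M) ≡ map f (endpoints M)
endpoints-map f []            = refl
endpoints-map f ((a , b) ∷ M) = cong (λ E → f a ∷ f b ∷ E) (endpoints-map f M)

IsMatching-inject : ∀ {m} (s : Vec Bool m) b {M} → IsMatching (Adj s) M →
  IsMatching (Adj (s ∷ʳ b)) (map injectEdge M)
IsMatching-inject s b {M} (adjacent , distinct) =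
  Allₚ.map⁺ (All.map (Adj-inject₁ s b) adjacent) ,
  subst Unique (sym (endpoints-map inject₁ M)) (Uniqueₚ.map⁺ inject₁-injective distinct)

IsMatching-new : ∀ {m} (s : Vec Bool m) {M v} → IsMatching (Adj s) M → v ∉ endpoints M →
  IsMatching (Adj (s ∷ʳ true)) ((fromℕ (suc m) , inject₁ v) ∷ map injectEdge M)
IsMatching-new {m} s {M} {v} (adjacent , distinct) v-free =
  Adj-new s v ∷ Allₚ.map⁺ (All.map (Adj-inject₁ s true) adjacent) ,
  subst (λ E → Unique (fromℕ (suc m) ∷ inject₁ v ∷ E)) (sym (endpoints-map inject₁ M))
    (Allₚ.map⁺ (All.tabulate λ _ → fromℕ≢inject₁) ∷
     Uniqueₚ.map⁺ inject₁-injective (Allₚ.¬Any⇒All¬ (endpoints M) v-free ∷ distinct))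

endpoints-take : ∀ {n} i (M : List (Fin n × Fin n)) → endpoints (take i M) ≡ take (i + i) (endpoints M)
endpoints-take zero    M             = refl
endpoints-take (suc i) []            = refl
endpoints-take (suc i) ((a , b) ∷ M) rewrite +-suc i i = cong (λ E → a ∷ b ∷ E) (endpoints-take i M)

IsMatching-take : ∀ {n} {adj : Fin n → Fin n → Set} i {M} → IsMatching adj M → IsMatching adj (take i M)
IsMatching-take i {M} (adjacent , distinct) =
  Allₚ.take⁺ i adjacent , subst Unique (sym (endpoints-take i M)) (Uniqueₚ.take⁺ (i + i) distinct)

m∸n≤1+[m∸[1+n]] : ∀ m n → m ∸ n ≤ suc (m ∸ suc n)
m∸n≤1+[m∸[1+n]] zero    zero    = z≤n
m∸n≤1+[m∸[1+n]] zero    (suc n) = z≤n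
m∸n≤1+[m∸[1+n]] (suc m) zero    = ≤-refl
m∸n≤1+[m∸[1+n]] (suc m) (suc n) = m∸n≤1+[m∸[1+n]] m n

[1+m]∸[n∸1]≤2+[m∸n] : ∀ m n → suc m ∸ (n ∸ 1) ≤ suc (suc (m ∸ n))
[1+m]∸[n∸1]≤2+[m∸n] m zero    = n≤1+n (suc m)
[1+m]∸[n∸1]≤2+[m∸n] m (suc n) = ≤-trans (m∸n≤1+[m∸[1+n]] (suc m) n) (s≤s (m∸n≤1+[m∸[1+n]] m n))

⌈n+n/2⌉≡n : ∀ n → ⌈ n + n /2⌉ ≡ n
⌈n+n/2⌉≡n zero    = refl
⌈n+n/2⌉≡n (suc n) = cong suc (trans (cong ⌊_/2⌋ (+-suc n n)) (⌈n+n/2⌉≡n n))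

n/2≡⌊n/2⌋ : ∀ n → n / 2 ≡ ⌊ n /2⌋
n/2≡⌊n/2⌋ zero          = refl
n/2≡⌊n/2⌋ (suc zero)    = refl
n/2≡⌊n/2⌋ (suc (suc n)) =
  trans (m/n≡1+[m∸n]/n {suc (suc n)} {2} (s≤s (s≤s z≤n))) (cong suc (n/2≡⌊n/2⌋ n))

νFormula-∷ʳ-false : ∀ {m} (s : Vec Bool m) → νFormula (s ∷ʳ false) ≡ νFormula s
νFormula-∷ʳ-false {m} s = cong (λ H → ⌊ (suc (suc m) ∸ H) /2⌋) (∣h∣-∷ʳ-false s)

νFormula-∷ʳ-true≤1+νFormula : ∀ {m} (s : Vec Bool m) → νFormula (s ∷ʳ true) ≤ suc (νFormula s)
νFormula-∷ʳ-true≤1+νFormula {m} s rewrite ∣h∣-∷ʳ-true s =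
  ⌊n/2⌋-mono ([1+m]∸[n∸1]≤2+[m∸n] (suc m) ∣ h s ∣)

νFormula-∷ʳ-true≤⌈n/2⌉ : ∀ {m} (s : Vec Bool m) → νFormula (s ∷ʳ true) ≤ ⌈ suc m /2⌉
νFormula-∷ʳ-true≤⌈n/2⌉ {m} s = ⌊n/2⌋-mono (m∸n≤m (suc (suc m)) ∣ h (s ∷ʳ true) ∣)

LargeMatching : ∀ {m} → Vec Bool m → Set
LargeMatching {m} s =
  Σ[ M ∈ List (Fin (suc m) × Fin (suc m)) ] IsMatching (Adj s) M × νFormula s ≤ length M

large-matching-∷ʳ : ∀ {m} (s : Vec Bool m) b → LargeMatching s → LargeMatching (s ∷ʳ b)
large-matching-∷ʳ s false (M , matching , ν≤∣M∣) =
  map injectEdge M , IsMatching-inject s false matching ,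
  subst₂ _≤_ (sym (νFormula-∷ʳ-false s)) (sym (length-map injectEdge M)) ν≤∣M∣
large-matching-∷ʳ {m} s true (M , matching , ν≤∣M∣) with free-or-covered (endpoints M)
... | inj₁ (v , v-free) =
  _ , IsMatching-new s matching v-free ,
  ≤-trans (νFormula-∷ʳ-true≤1+νFormula s)
    (s≤s (subst (νFormula s ≤_) (sym (length-map injectEdge M)) ν≤∣M∣))
... | inj₂ n≤∣E∣ =
  map injectEdge M , IsMatching-inject s true matching ,
  ≤-trans (νFormula-∷ʳ-true≤⌈n/2⌉ s) (subst (⌈ suc m /2⌉ ≤_) ⌈2∣M∣/2⌉≡∣M′∣ (⌊n/2⌋-mono (s≤s n≤2∣M∣)))
  where
  n≤2∣M∣ : suc m ≤ length M + length M
  n≤2∣M∣ = subst (suc m ≤_) (length-endpoints M) n≤∣E∣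
  ⌈2∣M∣/2⌉≡∣M′∣ : ⌈ length M + length M /2⌉ ≡ length (map injectEdge M)
  ⌈2∣M∣/2⌉≡∣M′∣ = trans (⌈n+n/2⌉≡n (length M)) (sym (length-map injectEdge M))

large-matching : ∀ m (s : Vec Bool m) → LargeMatching s
large-matching zero    []ᵛ = [] , ([] , []) , z≤n
large-matching (suc m) s with s′ , b , refl ← initLast s =
  large-matching-∷ʳ s′ b (large-matching m s′)

mainTheorem6 : ∀ (m : ℕ) (s : Vec Bool m) →
    IsMatchingNumber (Adj s) ((suc m ∸ ∣ h s ∣) / 2)
mainTheorem6 m s with M , matching , ν≤∣M∣ ← large-matching m s =
  subst (IsMatchingNumber (Adj s)) (sym (n/2≡⌊n/2⌋ (suc m ∸ ∣ h s ∣)))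
    ( (take (νFormula s) M , IsMatching-take (νFormula s) matching ,
       trans (length-take (νFormula s) M) (m≤n⇒m⊓n≡m ν≤∣M∣))
    , λ _ → matching-size≤νFormula s)
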